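{- Let \(\mathcal V\) be a universe. (i) There exists a locally small \(\delta_{\mathcal V}\)-complete poset with decidable equality that is nontrivial in an unspecified way if and only if weak excluded middle in \(\mathcal V\) holds. (ii) There exists a locally small \(\delta_{\mathcal V}\)-complete poset with decidable equality that is positive in an unspecified way if and only if excluded middle in \(\mathcal V\) holds.
   Context: Setting: intensional Martin-Löf type theory with universes, function extensionality, propositional extensionality and propositional truncation \(\|\cdot\|\), with \(\exists_{x:X}Y(x):=\|\Sigma_{x:X}Y(x)\|\); excluded middle and propositional resizing are not assumed. A proposition is a type with at most one element. Excluded middle in \(\mathcal V\): \(P\) or \(\neg P\) for every proposition \(P:\mathcal V\); weak excluded middle in \(\mathcal V\): \(\neg P\) or \(\neg\neg P\) for every proposition \(P:\mathcal V\). Decidable equality: for all \(a,b\), \(a=b\) or \(a\neq b\). A poset is a type \(X\) with a proposition-valued reflexive, transitive, antisymmetric relation \(\sqsubseteq\). For \(x\sqsubseteq y\) and a proposition \(P:\mathcal V\), \(\delta_{x,y,P}:\mathbf 1+P\to X\) sends \(\mathrm{inl}(\star)\mapsto x\), \(\mathrm{inr}(p)\mapsto y\); the poset is \(\delta_{\mathcal V}\)-complete if all such families have suprema \(\bigvee\delta_{x,y,P}\). Locally small: there is \(\sqsubseteq_{\mathcal V}:X\to X\to\mathcal V\) with \((x\sqsubseteq y)\simeq(x\sqsubseteq_{\mathcal V}y)\). In a \(\delta_{\mathcal V}\)-complete poset, \(x\) is strictly below \(y\) if \(x\sqsubseteq y\) and for every \(z\sqsupseteq y\) and proposition \(P:\mathcal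 V\), \(z=\bigvee\delta_{x,z,P}\) implies \(P\). Nontrivial in an unspecified way: \(\exists_{x:X}\exists_{y:X}((x\sqsubseteq y)\times(x\neq y))\); positive in an unspecified way: \(\exists_{x:X}\exists_{y:X}(x\text{ is strictly below }y)\). -}

module Defs where

open import Level using (Level; _⊔_; Setω) renaming (suc to lsuc)
open import Data.Unit.Polymorphic using (⊤; tt)
open import Data.Sum using (_⊎_; inj₁; inj₂)
open import Data.Product using (Σ; Σ-syntax; _×_; _,_; proj₁; proj₂)
open import Relation.Nullary using (¬_; Dec)
open import Relation.Binary.PropositionalEquality using (_≡_; _≢_)
open import Relation.Binary.Definitions using (DecidableEquality)
open import Function.Bundles using (_↔_)
open import Axiom.Extensionality.Propositional using (Extensionality)

isProp : ∀ {ℓ} → Set ℓ → Set ℓ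
isProp A = (x y : A) → x ≡ y

FunExt : Setω
FunExt = ∀ {a b} → Extensionality a b

PropExt : Setω
PropExt = ∀ {ℓ} {P Q : Set ℓ} → isProp P → isProp Q → (P → Q) → (Q → P) → P ≡ Q

record PropTrunc : Setω where
  field
    ∥_∥ : ∀ {ℓ} → Set ℓ → Set ℓ
    ∥∥-isProp : ∀ {ℓ} {A : Set ℓ} → isProp ∥ A ∥
    ∣_∣ : ∀ {ℓ} {A : Set ℓ} → A → ∥ A ∥
    ∥∥-rec : ∀ {ℓ ℓ'} {A : Set ℓ} {P : Set ℓ'} → isProp P → (A → P) → ∥ A ∥ → P

∃ₜ : (pt : PropTrunc) → ∀ {ℓ ℓ'} (X : Set ℓ) → (X → Set ℓ') → Set (ℓ ⊔ ℓ')
∃ₜ pt X Y = PropTrunc.∥_∥ pt (Σ X Y)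

EM : (𝓥 : Level) → Set (lsuc 𝓥)
EM 𝓥 = (P : Set 𝓥) → isProp P → P ⊎ ¬ P

WEM : (𝓥 : Level) → Set (lsuc 𝓥)
WEM 𝓥 = (P : Set 𝓥) → isProp P → ¬ P ⊎ ¬ ¬ P

record Poset (𝓤 𝓣 : Level) : Set (lsuc (𝓤 ⊔ 𝓣)) where
  field
    Carrier : Set 𝓤
    _⊑_ : Carrier → Carrier → Set 𝓣
    ⊑-prop : (x y : Carrier) → isProp (x ⊑ y)
    ⊑-refl : (x : Carrier) → x ⊑ x
    ⊑-trans : {x y z : Carrier} → x ⊑ y → y ⊑ z → x ⊑ z
    ⊑-antisym : {x y : Carrier} → x ⊑ y → y ⊑ x → x ≡ y

module _ {𝓤 𝓣 : Level} (X : Poset 𝓤 𝓣) where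
  open Poset X

  IsSup : ∀ {ℓ} {I : Set ℓ} → (I → Carrier) → Carrier → Set (𝓤 ⊔ 𝓣 ⊔ ℓ)
  IsSup α s = ((i : _) → α i ⊑ s) × ((u : Carrier) → ((i : _) → α i ⊑ u) → s ⊑ u)

  HasSup : ∀ {ℓ} {I : Set ℓ} → (I → Carrier) → Set (𝓤 ⊔ 𝓣 ⊔ ℓ)
  HasSup α = Σ Carrier (IsSup α)

  δ : ∀ {𝓥} → Carrier → Carrier → (P : Set 𝓥) → ⊤ {𝓥} ⊎ P → Carrier
  δ x y P (inj₁ _) = x
  δ x y P (inj₂ _) = y

  δ-Complete : (𝓥 : Level) → Set (𝓤 ⊔ 𝓣 ⊔ lsuc 𝓥)
  δ-Complete 𝓥 = (x y : Carrier) → x ⊑ y → (P : Set 𝓥) → isProp P → HasSup (δ x y P)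

  LocallySmall : (𝓥 : Level) → Set (𝓤 ⊔ 𝓣 ⊔ lsuc 𝓥)
  LocallySmall 𝓥 = Σ (Carrier → Carrier → Set 𝓥) λ R → (x y : Carrier) → (x ⊑ y) ↔ R x y

  HasDecidableEquality : Set 𝓤
  HasDecidableEquality = DecidableEquality Carrier

  ⋁δ : ∀ {𝓥} → δ-Complete 𝓥 → (x y : Carrier) → x ⊑ y → (P : Set 𝓥) → isProp P → Carrier
  ⋁δ c x y h P pP = proj₁ (c x y h P pP)

  StrictlyBelow : ∀ {𝓥} → δ-Complete 𝓥 → Carrier → Carrier → Set (𝓤 ⊔ 𝓣 ⊔ lsuc 𝓥)
  StrictlyBelow {𝓥} c x y =
    Σ (x ⊑ y) λ h → (z : Carrier) (k : y ⊑ z) (P : Set 𝓥) (pP : isProp P)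
      → z ≡ ⋁δ c x z (⊑-trans h k) P pP → P

  NontrivialUnspecified : PropTrunc → Set (𝓤 ⊔ 𝓣)
  NontrivialUnspecified pt =
    ∃ₜ pt Carrier λ x → ∃ₜ pt Carrier λ y → (x ⊑ y) × (x ≢ y)

  PositiveUnspecified : ∀ {𝓥} → PropTrunc → δ-Complete 𝓥 → Set (𝓤 ⊔ 𝓣 ⊔ lsuc 𝓥)
  PositiveUnspecified pt c =
    ∃ₜ pt Carrier λ x → ∃ₜ pt Carrier λ y → StrictlyBelow c x y

-- Given a δ-supremum s of δ_{x,y,P} with x ⊑ y, we have P → s = y and ¬ P → s = x.
-- Deciding s = x therefore decides ¬ P when x ≠ y, and deciding s = y decides P when
-- x is strictly below y. Conversely, the two-element poset 0 ⊑ 1 is δ-complete under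
-- WEM: take x as supremum when ¬ P and y when ¬¬ P, the latter being least because the
-- order is ¬¬-stable. Under EM, 0 is moreover strictly below 1.
module Submission where

open import Defs
open import Level using (Level)
open import Data.Product using (Σ; _×_; _,_; proj₁; proj₂)
open import Data.Sum using (_⊎_; inj₁; inj₂)
open import Data.Unit.Polymorphic using (⊤; tt)
open import Data.Empty using (⊥-elim)
import Data.Empty.Polymorphic as Polymorphic
open import Relation.Nullary using (¬_; yes; no)
open import Relation.Binary.Definitions using (DecidableEquality)
open import Relation.Binary.PropositionalEquality using (_≡_; _≢_; refl; sym; trans; cong; subst)
open import Function.Bundles using (_⇔_; mk⇔; mk↔ₛ′)

⊎-isProp : ∀ {a b} {A : Set a} {B : Set b}
  → isProp A → isProp B → (A → ¬ B) → isProp (A ⊎ B)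
⊎-isProp pA pB disj (inj₁ a) (inj₁ a′) = cong inj₁ (pA a a′)
⊎-isProp pA pB disj (inj₁ a) (inj₂ b)  = ⊥-elim (disj a b)
⊎-isProp pA pB disj (inj₂ b) (inj₁ a)  = ⊥-elim (disj a b)
⊎-isProp pA pB disj (inj₂ b) (inj₂ b′) = cong inj₂ (pB b b′)

¬-isProp : FunExt → ∀ {a} {A : Set a} → isProp (¬ A)
¬-isProp fe f g = fe λ a → ⊥-elim (f a)

EM-isProp : FunExt → ∀ 𝓥 → isProp (EM 𝓥)
EM-isProp fe 𝓥 em em′ = fe λ P → fe λ pP →
  ⊎-isProp pP (¬-isProp fe) (λ p np → np p) (em P pP) (em′ P pP)

WEM-isProp : FunExt → ∀ 𝓥 → isProp (WEM 𝓥)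
WEM-isProp fe 𝓥 wem wem′ = fe λ P → fe λ pP →
  ⊎-isProp (¬-isProp fe) (¬-isProp fe) (λ np nnp → nnp np) (wem P pP) (wem′ P pP)

EM⇒WEM : ∀ {𝓥} → EM 𝓥 → WEM 𝓥
EM⇒WEM em P pP with em P pP
... | inj₁ p  = inj₂ λ np → np p
... | inj₂ np = inj₁ np

module _ (pt : PropTrunc) where
  open PropTrunc pt

  ∃ₜ₂-rec : ∀ {a b c} {X : Set a} {R : X → X → Set b} {Q : Set c}
    → isProp Q → ((x y : X) → R x y → Q)
    → ∃ₜ pt X (λ x → ∃ₜ pt X (R x)) → Q
  ∃ₜ₂-rec pQ f = ∥∥-rec pQ λ (x , ∃y) → ∥∥-rec pQ (λ (y , r) → f x y r) ∃y

module _ {𝓤 𝓣 𝓥 : Level} (X : Poset 𝓤 𝓣) where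
  open Poset X

  module _ {x y s : Carrier} {P : Set 𝓥} (sup : IsSup X (δ X x y P) s) where
    private
      upper = proj₁ sup
      least = proj₂ sup

    δ-sup≡lower : ¬ P → s ≡ x
    δ-sup≡lower np = ⊑-antisym (least x bound) (upper (inj₁ tt))
      where
      bound : (i : ⊤ ⊎ P) → δ X x y P i ⊑ x
      bound (inj₁ _) = ⊑-refl x
      bound (inj₂ p) = ⊥-elim (np p)

    δ-sup≡upper : x ⊑ y → P → s ≡ y
    δ-sup≡upper x⊑y p = ⊑-antisym (least y bound) (upper (inj₂ p))
      where
      bound : (i : ⊤ ⊎ P) → δ X x y P i ⊑ y
      bound (inj₁ _) = x⊑y
      bound (inj₂ _) = ⊑-refl y

  δ-isSup-upper-of-¬¬ : (∀ {u v} → ¬ ¬ (u ⊑ v) → u ⊑ v)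
    → {x y : Carrier} → x ⊑ y → {P : Set 𝓥} → ¬ ¬ P → IsSup X (δ X x y P) y
  δ-isSup-upper-of-¬¬ ⊑-stable x⊑y nnp = upper , least
    where
    upper : (i : ⊤ ⊎ _) → δ X _ _ _ i ⊑ _
    upper (inj₁ _) = x⊑y
    upper (inj₂ _) = ⊑-refl _
    least : (u : Carrier) → ((i : ⊤ ⊎ _) → δ X _ _ _ i ⊑ u) → _ ⊑ u
    least u bounded = ⊑-stable λ y⋢u → nnp λ p → y⋢u (bounded (inj₂ p))

  δ-isSup-lower-of-¬ : {x y : Carrier} {P : Set 𝓥} → ¬ P → IsSup X (δ X x y P) x
  δ-isSup-lower-of-¬ np = upper , λ u bounded → bounded (inj₁ tt)
    where
    upper : (i : ⊤ ⊎ _) → δ X _ _ _ i ⊑ _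
    upper (inj₁ _) = ⊑-refl _
    upper (inj₂ p) = ⊥-elim (np p)

  δ-complete-of-WEM : (∀ {u v} → ¬ ¬ (u ⊑ v) → u ⊑ v) → WEM 𝓥 → δ-Complete X 𝓥
  δ-complete-of-WEM ⊑-stable wem x y x⊑y P pP with wem P pP
  ... | inj₁ np  = x , δ-isSup-lower-of-¬ np
  ... | inj₂ nnp = y , δ-isSup-upper-of-¬¬ ⊑-stable x⊑y nnp

  module _ (c : δ-Complete X 𝓥) where
    private
      ⋁δ-isSup : (x y : Carrier) (x⊑y : x ⊑ y) (P : Set 𝓥) (pP : isProp P)
        → IsSup X (δ X x y P) (⋁δ X c x y x⊑y P pP)
      ⋁δ-isSup x y x⊑y P pP = proj₂ (c x y x⊑y P pP)

    strictlyBelow-of-EM : EM 𝓥 → {x y : Carrier} → x ⊑ y → x ≢ y → StrictlyBelow X c x y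
    strictlyBelow-of-EM em {x} {y} x⊑y x≢y = x⊑y , below
      where
      below : (z : Carrier) (y⊑z : y ⊑ z) (P : Set 𝓥) (pP : isProp P)
        → z ≡ ⋁δ X c x z (⊑-trans x⊑y y⊑z) P pP → P
      below z y⊑z P pP z≡⋁ with em P pP
      ... | inj₁ p  = p
      ... | inj₂ np = ⊥-elim (x≢y (⊑-antisym x⊑y (subst (y ⊑_) z≡x y⊑z)))
        where
        z≡x : z ≡ x
        z≡x = trans z≡⋁ (δ-sup≡lower (⋁δ-isSup x z _ P pP) np)

    module _ (_≟_ : HasDecidableEquality X) where

      WEM-of-nontrivial : (x y : Carrier) → (x ⊑ y) × (x ≢ y) → WEM 𝓥
      WEM-of-nontrivial x y (x⊑y , x≢y) P pP with ⋁δ X c x y x⊑y P pP ≟ x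
      ... | yes ⋁≡x = inj₁ λ p → x≢y (trans (sym ⋁≡x) (δ-sup≡upper (⋁δ-isSup x y x⊑y P pP) x⊑y p))
      ... | no ⋁≢x  = inj₂ λ np → ⋁≢x (δ-sup≡lower (⋁δ-isSup x y x⊑y P pP) np)

      EM-of-strictlyBelow : (x y : Carrier) → StrictlyBelow X c x y → EM 𝓥
      EM-of-strictlyBelow x y (x⊑y , below) P pP with ⋁δ X c x y x⊑y P pP ≟ y
      ... | yes ⋁≡y = inj₁ (below y (⊑-refl y) P pP y≡⋁)
        where
        y≡⋁ : y ≡ ⋁δ X c x y (⊑-trans x⊑y (⊑-refl y)) P pP
        y≡⋁ = subst (λ h → y ≡ ⋁δ X c x y h P pP)
                    (⊑-prop x y x⊑y (⊑-trans x⊑y (⊑-refl y))) (sym ⋁≡y)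
      ... | no ⋁≢y  = inj₂ λ p → ⋁≢y (δ-sup≡upper (⋁δ-isSup x y x⊑y P pP) x⊑y p)

data 𝟚 (𝓤 : Level) : Set 𝓤 where
  𝟎 𝟏 : 𝟚 𝓤

module _ {𝓤 : Level} where

  _≤[_]_ : 𝟚 𝓤 → (𝓣 : Level) → 𝟚 𝓤 → Set 𝓣
  𝟏 ≤[ 𝓣 ] 𝟎 = Polymorphic.⊥
  _ ≤[ 𝓣 ] _ = ⊤

  module _ {𝓣 : Level} where

    ≤-isProp : (x y : 𝟚 𝓤) → isProp (x ≤[ 𝓣 ] y)
    ≤-isProp 𝟎 _ _ _ = refl
    ≤-isProp 𝟏 𝟏 _ _ = refl

    ≤-refl : (x : 𝟚 𝓤) → x ≤[ 𝓣 ] x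
    ≤-refl 𝟎 = tt
    ≤-refl 𝟏 = tt

    ≤-trans : {x y z : 𝟚 𝓤} → x ≤[ 𝓣 ] y → y ≤[ 𝓣 ] z → x ≤[ 𝓣 ] z
    ≤-trans {𝟎}         _ _ = tt
    ≤-trans {𝟏} {𝟏} {𝟏} _ _ = tt

    ≤-antisym : {x y : 𝟚 𝓤} → x ≤[ 𝓣 ] y → y ≤[ 𝓣 ] x → x ≡ y
    ≤-antisym {𝟎} {𝟎} _ _ = refl
    ≤-antisym {𝟏} {𝟏} _ _ = refl

    ≤-stable : {x y : 𝟚 𝓤} → ¬ ¬ (x ≤[ 𝓣 ] y) → x ≤[ 𝓣 ] y
    ≤-stable {𝟎}     _   = tt
    ≤-stable {𝟏} {𝟎} nn≤ = ⊥-elim (nn≤ λ ())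
    ≤-stable {𝟏} {𝟏} _   = tt

    ≤-resize : ∀ {𝓥} {x y : 𝟚 𝓤} → x ≤[ 𝓣 ] y → x ≤[ 𝓥 ] y
    ≤-resize {x = 𝟎}         _ = tt
    ≤-resize {x = 𝟏} {y = 𝟏} _ = tt

  𝟚-poset : (𝓣 : Level) → Poset 𝓤 𝓣
  𝟚-poset 𝓣 = record
    { Carrier = 𝟚 𝓤 ; _⊑_ = _≤[ 𝓣 ]_ ; ⊑-prop = ≤-isProp ; ⊑-refl = ≤-refl
    ; ⊑-trans = ≤-trans ; ⊑-antisym = ≤-antisym }

  𝟚-locallySmall : ∀ {𝓣} 𝓥 → LocallySmall (𝟚-poset 𝓣) 𝓥
  𝟚-locallySmall 𝓥 = _≤[ 𝓥 ]_ , λ x y →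
    mk↔ₛ′ ≤-resize ≤-resize (λ _ → ≤-isProp x y _ _) (λ _ → ≤-isProp x y _ _)

  _≟_ : DecidableEquality (𝟚 𝓤)
  𝟎 ≟ 𝟎 = yes refl
  𝟎 ≟ 𝟏 = no λ ()
  𝟏 ≟ 𝟎 = no λ ()
  𝟏 ≟ 𝟏 = yes refl

  𝟎≢𝟏 : _≢_ {A = 𝟚 𝓤} 𝟎 𝟏
  𝟎≢𝟏 ()

theorem3p30 : FunExt → PropExt → (pt : PropTrunc) → (𝓥 𝓤 𝓣 : Level)
    → (PropTrunc.∥_∥ pt (Σ (Poset 𝓤 𝓣) λ X → LocallySmall X 𝓥 × Σ (δ-Complete X 𝓥) λ c → HasDecidableEquality X × NontrivialUnspecified X pt) ⇔ WEM 𝓥)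
    × (PropTrunc.∥_∥ pt (Σ (Poset 𝓤 𝓣) λ X → LocallySmall X 𝓥 × Σ (δ-Complete X 𝓥) λ c → HasDecidableEquality X × PositiveUnspecified X pt c) ⇔ EM 𝓥)
theorem3p30 fe _ pt 𝓥 𝓤 𝓣 =
  mk⇔ (∥∥-rec (WEM-isProp fe 𝓥) λ (X , _ , c , ≟X , nontrivial) →
         ∃ₜ₂-rec pt (WEM-isProp fe 𝓥) (WEM-of-nontrivial X c ≟X) nontrivial)
      (λ wem → ∣ 𝟚-poset 𝓣 , 𝟚-locallySmall 𝓥 , 𝟚-complete wem , _≟_
               , ∣ 𝟎 , ∣ 𝟏 , tt , 𝟎≢𝟏 ∣ ∣ ∣)
  , mk⇔ (∥∥-rec (EM-isProp fe 𝓥) λ (X , _ , c , ≟X , positive) →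
         ∃ₜ₂-rec pt (EM-isProp fe 𝓥) (EM-of-strictlyBelow X c ≟X) positive)
      (λ em → ∣ 𝟚-poset 𝓣 , 𝟚-locallySmall 𝓥 , 𝟚-complete (EM⇒WEM em) , _≟_
              , ∣ 𝟎 , ∣ 𝟏 , strictlyBelow-of-EM (𝟚-poset 𝓣) (𝟚-complete (EM⇒WEM em)) em tt 𝟎≢𝟏 ∣ ∣ ∣)
  where
  open PropTrunc pt
  𝟚-complete : WEM 𝓥 → δ-Complete (𝟚-poset {𝓤} 𝓣) 𝓥
  𝟚-complete = δ-complete-of-WEM (𝟚-poset 𝓣) ≤-stable
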